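{- Let $k$ be a positive integer and let $D$ be a digraph of order $n$ with no isolated vertex and maximum out-degree $\Delta^+$. Then $\gamma_{trk}(D)\ge\left\lceil\frac{kn+1}{\Delta^++k}\right\rceil$, and this lower bound is sharp (for every positive integer $k$ there is a digraph with no isolated vertex attaining equality).
   Context: All digraphs are finite, without loops or multiple arcs (pairs of opposite arcs are allowed). $N^-(v)$ is the set of in-neighbors of $v$; $\Delta^+$ is the maximum out-degree. A vertex is isolated if it has no in- or out-neighbors. A $k$RDF on $D$ is a function $f:V(D)\to\mathcal{P}(\{1,\dots,k\})$ such that every $v$ with $f(v)=\emptyset$ satisfies $\bigcup_{u\in N^-(v)}f(u)=\{1,\dots,k\}$; its weight is $\sum_v|f(v)|$. For $D$ with no isolated vertex, a T$k$RDF is a $k$RDF $f$ such that the subdigraph induced by $\{v:f(v)\neq\emptyset\}$ has no isolated vertex; $\gamma_{trk}(D)$ is the minimum weight of a T$k$RDF. -}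

module Defs where

open import Data.Nat using (ℕ; zero; suc; _+_; _*_; _∸_; _⊔_; _/_; _≤_)
open import Data.Bool using (Bool; true; false; T)
open import Data.Fin using (Fin)
open import Data.Fin.Subset using (Subset; ∣_∣; _∈_; ⊤; ⋃)
open import Data.List using (List; map; foldr; sum; filter)
open import Data.List using () renaming (length to len)
open import Data.Vec using (Vec; tabulate; toList)
open import Data.Vec.Functional using () renaming (foldr to vfoldr)
open import Data.Product using (Σ; _×_; ∃; _,_)
open import Relation.Nullary using (¬_)
open import Relation.Binary.PropositionalEquality using (_≡_)

-- A digraph on vertex set Fin n: arc relation given by a Boolean adjacency
-- matrix; no loops (pairs of opposite arcs allowed, no multiple arcs automatically).
record Digraph (n : ℕ) : Set where
  field
    arc   : Fin n → Fin n → Bool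
    loopless : ∀ v → arc v v ≡ false
open Digraph public

Arc : ∀ {n} → Digraph n → Fin n → Fin n → Set
Arc D u v = T (arc D u v)

outdeg : ∀ {n} → Digraph n → Fin n → ℕ
outdeg {n} D v = ∣ tabulate (λ u → arc D v u) ∣

Δ⁺ : ∀ {n} → Digraph n → ℕ
Δ⁺ {n} D = vfoldr _⊔_ 0 (outdeg D)

Isolated : ∀ {n} → Digraph n → Fin n → Set
Isolated D v = (∀ u → ¬ Arc D u v) × (∀ u → ¬ Arc D v u)

NoIsolated : ∀ {n} → Digraph n → Set
NoIsolated D = ∀ v → ¬ Isolated D v

Labelling : ℕ → ℕ → Set
Labelling n k = Fin n → Subset k

IsEmpty : ∀ {k} → Subset k → Set
IsEmpty s = ∣ s ∣ ≡ 0

IsKRDF : ∀ {n} k → Digraph n → Labelling n k → Set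
IsKRDF {n} k D f =
  ∀ v → IsEmpty (f v) → ∀ (i : Fin k) → ∃ λ u → Arc D u v × i ∈ f u

-- total k-RDF: the subdigraph induced by {v : f(v) ≠ ∅} has no isolated vertex
IsTKRDF : ∀ {n} k → Digraph n → Labelling n k → Set
IsTKRDF {n} k D f =
  IsKRDF k D f ×
  (∀ v → ¬ IsEmpty (f v) →
     ∃ λ u → ¬ IsEmpty (f u) × (Arc D u v Data.Sum.⊎ Arc D v u))
  where import Data.Sum

weight : ∀ {n k} → Labelling n k → ℕ
weight {n} f = vfoldr _+_ 0 (λ v → ∣ f v ∣)

IsGammaTRK : ∀ {n} k → Digraph n → ℕ → Set
IsGammaTRK {n} k D m =
  (∃ λ f → IsTKRDF k D f × weight f ≡ m) ×
  (∀ f → IsTKRDF k D f → m ≤ weight f)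

-- ceiling division ⌈ a / b ⌉ (for b ≥ 1; the value at b = 0 is an
-- irrelevant convention and never used since b = Δ⁺ + k with k ≥ 1)
⌈_/_⌉ : ℕ → ℕ → ℕ
⌈ a / zero ⌉ = 0
⌈ a / suc b ⌉ = (a + b) / suc b

-- Every vertex v contributes at least k to k ∣ f v ∣ + [f v = ∅] ∑_{u → v} ∣ f u ∣:
-- a labelled vertex through its own label, an unlabelled one because the labels
-- of its in-neighbours cover {1..k}. Summing over v and exchanging the double sum,
-- k n ≤ k w + ∑ᵤ ∣ f u ∣ · (number of unlabelled out-neighbours of u) ≤ k w + Δ⁺ w.
-- Totality gives an arc between two labelled vertices, which makes the last step
-- strict, so k n + 1 ≤ (Δ⁺ + k) w. The 2-cycle labelled {1} at both vertices
-- attains the bound.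
module Submission where

open import Defs
open import Data.Bool using (Bool; true; false; T; not; if_then_else_)
open import Data.Empty using (⊥-elim)
open import Data.Fin using (Fin; zero; suc) renaming (_≟_ to _≟ᶠ_)
open import Data.Fin.Subset using (Subset; ∣_∣; _∈_; _∪_; ⊤; ⊥; ⁅_⁆)
open import Data.Fin.Subset.Properties
  using (∣⊥∣≡0; ∣⊤∣≡n; ∣⁅x⁆∣≡1; x∈⁅x⁆; p⊆q⇒∣p∣≤∣q∣; x∈p∪q⁺; x∈p⇒∣p-x∣<∣p∣)
open import Data.Nat
  using (ℕ; zero; suc; _+_; _*_; _∸_; _≤_; _<_; _⊔_; NonZero; ≢-nonZero; z≤n; s≤s; s≤s⁻¹)
open import Data.Nat.DivMod using (m<n*o⇒m/o<n; m*n/n≡m; /-monoˡ-≤)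
open import Data.Nat.Properties
open import Algebra.Properties.CommutativeSemigroup *-commutativeSemigroup using (x∙yz≈z∙yx)
open import Algebra.Properties.Semiring.Sum +-*-semiring
  using (sum; sum-syntax; sum-cong-≗; ∑-comm; ∑-distrib-+; *-distribˡ-sum)
open import Data.Nat.Tactic.RingSolver using (solve-∀)
open import Data.Product using (Σ; _×_; ∃; _,_)
open import Data.Sum using (_⊎_; inj₁; inj₂)
open import Data.Unit using (tt)
open import Data.Vec using ([]; _∷_; tabulate)
open import Data.Vec.Functional using () renaming (foldr to vfoldr)
open import Function using (_∘_)
open import Relation.Nullary using (¬_; yes; no; ⌊_⌋)
open import Relation.Binary.PropositionalEquality
  using (_≡_; refl; sym; trans; cong; cong₂; subst; module ≡-Reasoning)

∑-mono-≤ : ∀ {n} {a b : Fin n → ℕ} → (∀ i → a i ≤ b i) → sum a ≤ sum b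
∑-mono-≤ {zero}  _   = z≤n
∑-mono-≤ {suc n} a≤b = +-mono-≤ (a≤b zero) (∑-mono-≤ (a≤b ∘ suc))

∑-mono-< : ∀ {n} {a b : Fin n → ℕ} → (∀ i → a i ≤ b i) → ∀ j → a j < b j → sum a < sum b
∑-mono-< a≤b zero    aj<bj = +-mono-<-≤ aj<bj (∑-mono-≤ (a≤b ∘ suc))
∑-mono-< a≤b (suc j) aj<bj = +-mono-≤-< (a≤b zero) (∑-mono-< (a≤b ∘ suc) j aj<bj)

∑-const : ∀ n c → ∑[ i < n ] c ≡ n * c
∑-const zero    c = refl
∑-const (suc n) c = cong (c +_) (∑-const n c)

lookup≤foldr-⊔ : ∀ {n} (a : Fin n → ℕ) i → a i ≤ vfoldr _⊔_ 0 a
lookup≤foldr-⊔ a zero    = m≤m⊔n (a zero) _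
lookup≤foldr-⊔ a (suc i) = ≤-trans (lookup≤foldr-⊔ (a ∘ suc) i) (m≤n⊔m (a zero) _)

𝟙 : Bool → ℕ
𝟙 true  = 1
𝟙 false = 0

T⇒𝟙≡1 : ∀ {b} → T b → 𝟙 b ≡ 1
T⇒𝟙≡1 {true} _ = refl

∣tabulate∣≡∑𝟙 : ∀ {n} (b : Fin n → Bool) → ∣ tabulate b ∣ ≡ ∑[ i < n ] 𝟙 (b i)
∣tabulate∣≡∑𝟙 {zero}  b = refl
∣tabulate∣≡∑𝟙 {suc n} b with b zero
... | true  = cong suc (∣tabulate∣≡∑𝟙 (b ∘ suc))
... | false = ∣tabulate∣≡∑𝟙 (b ∘ suc)

∣if∣≡𝟙*∣∣ : ∀ {k} b (p : Subset k) → ∣ if b then p else ⊥ ∣ ≡ 𝟙 b * ∣ p ∣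
∣if∣≡𝟙*∣∣ true  p = sym (+-identityʳ _)
∣if∣≡𝟙*∣∣ {k} false p = ∣⊥∣≡0 k

∈-if : ∀ {k b} {p q : Subset k} {i} → T b → i ∈ p → i ∈ (if b then p else q)
∈-if {b = true} _ i∈p = i∈p

∈⇒nonempty : ∀ {k} {p : Subset k} {i} → i ∈ p → ¬ IsEmpty p
∈⇒nonempty i∈p = m<n⇒n≢0 (x∈p⇒∣p-x∣<∣p∣ i∈p)

∣p∪q∣≤∣p∣+∣q∣ : ∀ {k} (p q : Subset k) → ∣ p ∪ q ∣ ≤ ∣ p ∣ + ∣ q ∣
∣p∪q∣≤∣p∣+∣q∣ []          []          = z≤n
∣p∪q∣≤∣p∣+∣q∣ (true  ∷ p) (true  ∷ q) = s≤s (≤-trans (∣p∪q∣≤∣p∣+∣q∣ p q) (+-monoʳ-≤ ∣ p ∣ (n≤1+n _)))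
∣p∪q∣≤∣p∣+∣q∣ (true  ∷ p) (false ∷ q) = s≤s (∣p∪q∣≤∣p∣+∣q∣ p q)
∣p∪q∣≤∣p∣+∣q∣ (false ∷ p) (true  ∷ q) = ≤-trans (s≤s (∣p∪q∣≤∣p∣+∣q∣ p q)) (≤-reflexive (sym (+-suc ∣ p ∣ ∣ q ∣)))
∣p∪q∣≤∣p∣+∣q∣ (false ∷ p) (false ∷ q) = ∣p∪q∣≤∣p∣+∣q∣ p q

⋃ᶠ : ∀ {n k} → (Fin n → Subset k) → Subset k
⋃ᶠ = vfoldr _∪_ ⊥

∈⋃ᶠ : ∀ {n k} (p : Fin n → Subset k) u {i} → i ∈ p u → i ∈ ⋃ᶠ p
∈⋃ᶠ p zero    i∈pu = x∈p∪q⁺ (inj₁ i∈pu)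
∈⋃ᶠ p (suc u) i∈pu = x∈p∪q⁺ (inj₂ (∈⋃ᶠ (p ∘ suc) u i∈pu))

∣⋃ᶠ∣≤∑∣∣ : ∀ {n k} (p : Fin n → Subset k) → ∣ ⋃ᶠ p ∣ ≤ ∑[ u < n ] ∣ p u ∣
∣⋃ᶠ∣≤∑∣∣ {zero} {k} p = ≤-reflexive (∣⊥∣≡0 k)
∣⋃ᶠ∣≤∑∣∣ {suc n}     p = ≤-trans (∣p∪q∣≤∣p∣+∣q∣ (p zero) _) (+-monoʳ-≤ ∣ p zero ∣ (∣⋃ᶠ∣≤∑∣∣ (p ∘ suc)))

cover⇒k≤∑∣∣ : ∀ {n k} (p : Fin n → Subset k) → (∀ i → ∃ λ u → i ∈ p u) → k ≤ ∑[ u < n ] ∣ p u ∣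
cover⇒k≤∑∣∣ {n} {k} p covers = begin
  k                   ≡⟨ sym (∣⊤∣≡n k) ⟩
  ∣ ⊤ {k} ∣           ≤⟨ p⊆q⇒∣p∣≤∣q∣ ⊤⊆⋃ᶠp ⟩
  ∣ ⋃ᶠ p ∣            ≤⟨ ∣⋃ᶠ∣≤∑∣∣ p ⟩
  ∑[ u < n ] ∣ p u ∣  ∎
  where
  open ≤-Reasoning
  ⊤⊆⋃ᶠp : ∀ {i} → i ∈ ⊤ {k} → i ∈ ⋃ᶠ p
  ⊤⊆⋃ᶠp {i} _ with covers i
  ... | u , i∈pu = ∈⋃ᶠ p u i∈pu

k≤k*m+[m≡0]*s : ∀ k m s → (m ≡ 0 → k ≤ s) → k ≤ k * m + (1 ∸ m) * s
k≤k*m+[m≡0]*s k zero    s k≤s = ≤-trans (k≤s refl) (≤-trans (m≤m+n s 0) (m≤n+m _ (k * 0)))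
k≤k*m+[m≡0]*s k (suc m) s _   = ≤-trans (m≤m*n k (suc m)) (m≤m+n _ _)

k*n≤k*w+s→s<d*w→k*n+1≤[d+k]*w : ∀ {k n w s d} → k * n ≤ k * w + s → s < d * w → k * n + 1 ≤ (d + k) * w
k*n≤k*w+s→s<d*w→k*n+1≤[d+k]*w {k} {n} {w} {s} {d} kn≤kw+s s<dw = begin
  k * n + 1       ≡⟨ +-comm (k * n) 1 ⟩
  suc (k * n)     ≤⟨ s≤s kn≤kw+s ⟩
  suc (k * w + s) ≡⟨ sym (+-suc (k * w) s) ⟩
  k * w + suc s   ≤⟨ +-monoʳ-≤ (k * w) s<dw ⟩
  k * w + d * w   ≡⟨ +-comm (k * w) (d * w) ⟩
  d * w + k * w   ≡⟨ sym (*-distribʳ-+ w d k) ⟩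
  (d + k) * w     ∎
  where open ≤-Reasoning

module _ {n k} (D : Digraph n) (f : Labelling n k) where

  private
    A : Fin n → Fin n → ℕ
    A u v = 𝟙 (arc D u v)

    -- the indicator of f v = ∅
    E : Fin n → ℕ
    E v = 1 ∸ ∣ f v ∣

  inWeight : Fin n → ℕ
  inWeight v = ∑[ u < n ] (A u v * ∣ f u ∣)

  emptyOutdeg : Fin n → ℕ
  emptyOutdeg u = ∑[ v < n ] (A u v * E v)

  empty⇒k≤inWeight : IsKRDF k D f → ∀ v → IsEmpty (f v) → k ≤ inWeight v
  empty⇒k≤inWeight isKRDF v fv≡∅ = begin
    k                         ≤⟨ cover⇒k≤∑∣∣ inLabel covers ⟩
    ∑[ u < n ] ∣ inLabel u ∣  ≡⟨ sum-cong-≗ (λ u → ∣if∣≡𝟙*∣∣ (arc D u v) (f u)) ⟩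
    inWeight v                ∎
    where
    open ≤-Reasoning
    inLabel : Fin n → Subset k
    inLabel u = if arc D u v then f u else ⊥
    covers : ∀ i → ∃ λ u → i ∈ inLabel u
    covers i with isKRDF v fv≡∅ i
    ... | u , u→v , i∈fu = u , ∈-if u→v i∈fu

  ∑E*inWeight≡∑∣f∣*emptyOutdeg :
    ∑[ v < n ] (E v * inWeight v) ≡ ∑[ u < n ] (∣ f u ∣ * emptyOutdeg u)
  ∑E*inWeight≡∑∣f∣*emptyOutdeg = begin
    ∑[ v < n ] (E v * inWeight v)                       ≡⟨ sum-cong-≗ (λ v → *-distribˡ-sum (E v) (λ u → A u v * ∣ f u ∣)) ⟩
    ∑[ v < n ] ∑[ u < n ] (E v * (A u v * ∣ f u ∣))     ≡⟨ ∑-comm (λ v u → E v * (A u v * ∣ f u ∣)) ⟩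
    ∑[ u < n ] ∑[ v < n ] (E v * (A u v * ∣ f u ∣))     ≡⟨ sum-cong-≗ (λ u → sum-cong-≗ (λ v → x∙yz≈z∙yx (E v) (A u v) ∣ f u ∣)) ⟩
    ∑[ u < n ] ∑[ v < n ] (∣ f u ∣ * (A u v * E v))     ≡⟨ sum-cong-≗ (λ u → sym (*-distribˡ-sum ∣ f u ∣ (λ v → A u v * E v))) ⟩
    ∑[ u < n ] (∣ f u ∣ * emptyOutdeg u)                ∎
    where open ≡-Reasoning

  k*n≤k*w+∑∣f∣*emptyOutdeg :
    IsKRDF k D f → k * n ≤ k * weight f + ∑[ u < n ] (∣ f u ∣ * emptyOutdeg u)
  k*n≤k*w+∑∣f∣*emptyOutdeg isKRDF = begin
    k * n                                                    ≡⟨ *-comm k n ⟩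
    n * k                                                    ≡⟨ sym (∑-const n k) ⟩
    ∑[ v < n ] k                                             ≤⟨ ∑-mono-≤ each-vertex ⟩
    ∑[ v < n ] (k * ∣ f v ∣ + E v * inWeight v)              ≡⟨ ∑-distrib-+ (λ v → k * ∣ f v ∣) (λ v → E v * inWeight v) ⟩
    ∑[ v < n ] (k * ∣ f v ∣) + ∑[ v < n ] (E v * inWeight v) ≡⟨ cong₂ _+_ (sym (*-distribˡ-sum k (λ v → ∣ f v ∣)))
                                                                         ∑E*inWeight≡∑∣f∣*emptyOutdeg ⟩
    k * weight f + ∑[ u < n ] (∣ f u ∣ * emptyOutdeg u)      ∎
    where
    open ≤-Reasoning
    each-vertex : ∀ v → k ≤ k * ∣ f v ∣ + E v * inWeight v
    each-vertex v = k≤k*m+[m≡0]*s k ∣ f v ∣ (inWeight v) (empty⇒k≤inWeight isKRDF v)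

  outdeg≤Δ⁺ : ∀ u → outdeg D u ≤ Δ⁺ D
  outdeg≤Δ⁺ = lookup≤foldr-⊔ (outdeg D)

  ∑A≡outdeg : ∀ u → ∑[ v < n ] A u v ≡ outdeg D u
  ∑A≡outdeg u = sym (∣tabulate∣≡∑𝟙 (arc D u))

  A*E≤A : ∀ u v → A u v * E v ≤ A u v
  A*E≤A u v = ≤-trans (*-monoʳ-≤ (A u v) (m∸n≤m 1 ∣ f v ∣)) (≤-reflexive (*-identityʳ (A u v)))

  emptyOutdeg≤Δ⁺ : ∀ u → emptyOutdeg u ≤ Δ⁺ D
  emptyOutdeg≤Δ⁺ u = begin
    emptyOutdeg u      ≤⟨ ∑-mono-≤ (A*E≤A u) ⟩
    ∑[ v < n ] A u v   ≡⟨ ∑A≡outdeg u ⟩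
    outdeg D u         ≤⟨ outdeg≤Δ⁺ u ⟩
    Δ⁺ D               ∎
    where open ≤-Reasoning

  emptyOutdeg<Δ⁺ : ∀ {u x} → Arc D u x → ¬ IsEmpty (f x) → emptyOutdeg u < Δ⁺ D
  emptyOutdeg<Δ⁺ {u} {x} u→x fx≢∅ = begin-strict
    emptyOutdeg u      <⟨ ∑-mono-< (A*E≤A u) x Aux*Ex<Aux ⟩
    ∑[ v < n ] A u v   ≡⟨ ∑A≡outdeg u ⟩
    outdeg D u         ≤⟨ outdeg≤Δ⁺ u ⟩
    Δ⁺ D               ∎
    where
    open ≤-Reasoning
    Aux*Ex<Aux : A u x * E x < A u x
    Aux*Ex<Aux = begin-strict
      A u x * E x  ≡⟨ cong₂ _*_ (T⇒𝟙≡1 u→x) (m≤n⇒m∸n≡0 (n≢0⇒n>0 fx≢∅)) ⟩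
      0            <⟨ s≤s z≤n ⟩
      1            ≡⟨ sym (T⇒𝟙≡1 u→x) ⟩
      A u x        ∎

  ∑∣f∣*emptyOutdeg<Δ⁺*w : ∀ {u x} → Arc D u x → ¬ IsEmpty (f u) → ¬ IsEmpty (f x) →
    ∑[ v < n ] (∣ f v ∣ * emptyOutdeg v) < Δ⁺ D * weight f
  ∑∣f∣*emptyOutdeg<Δ⁺*w {u} u→x fu≢∅ fx≢∅ = begin-strict
    ∑[ v < n ] (∣ f v ∣ * emptyOutdeg v) <⟨ ∑-mono-< (λ v → *-monoʳ-≤ ∣ f v ∣ (emptyOutdeg≤Δ⁺ v)) u strictAtU ⟩
    ∑[ v < n ] (∣ f v ∣ * Δ⁺ D)          ≡⟨ sum-cong-≗ (λ v → *-comm ∣ f v ∣ (Δ⁺ D)) ⟩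
    ∑[ v < n ] (Δ⁺ D * ∣ f v ∣)          ≡⟨ sym (*-distribˡ-sum (Δ⁺ D) (λ v → ∣ f v ∣)) ⟩
    Δ⁺ D * weight f                      ∎
    where
    open ≤-Reasoning
    strictAtU : ∣ f u ∣ * emptyOutdeg u < ∣ f u ∣ * Δ⁺ D
    strictAtU = *-monoʳ-< ∣ f u ∣ {{≢-nonZero fu≢∅}} (emptyOutdeg<Δ⁺ u→x fx≢∅)

  nonempty-vertex : IsKRDF k D f → Fin k → Fin n → ∃ λ v → ¬ IsEmpty (f v)
  nonempty-vertex isKRDF i v with ∣ f v ∣ ≟ 0
  ... | no  fv≢∅ = v , fv≢∅
  ... | yes fv≡∅ with isKRDF v fv≡∅ i
  ...   | u , _ , i∈fu = u , ∈⇒nonempty i∈fu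

  labelled-arc : IsTKRDF k D f → Fin k → Fin n →
    ∃ λ u → ∃ λ x → Arc D u x × ¬ IsEmpty (f u) × ¬ IsEmpty (f x)
  labelled-arc (isKRDF , total) i v₀ with nonempty-vertex isKRDF i v₀
  ... | v , fv≢∅ with total v fv≢∅
  ...   | x , fx≢∅ , inj₁ x→v = x , v , x→v , fx≢∅ , fv≢∅
  ...   | x , fx≢∅ , inj₂ v→x = v , x , v→x , fv≢∅ , fx≢∅

  k*n+1≤[Δ⁺+k]*w : IsTKRDF k D f → Fin k → Fin n → k * n + 1 ≤ (Δ⁺ D + k) * weight f
  k*n+1≤[Δ⁺+k]*w isTKRDF@(isKRDF , _) i v with labelled-arc isTKRDF i v
  ... | u , x , u→x , fu≢∅ , fx≢∅ =
    k*n≤k*w+s→s<d*w→k*n+1≤[d+k]*w {d = Δ⁺ D}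
      (k*n≤k*w+∑∣f∣*emptyOutdeg isKRDF)
      (∑∣f∣*emptyOutdeg<Δ⁺*w u→x fu≢∅ fx≢∅)

⌈/⌉≤ : ∀ {a c w} .{{_ : NonZero c}} → a ≤ c * w → ⌈ a / c ⌉ ≤ w
⌈/⌉≤ {a} {suc b} {w} a≤cw = s≤s⁻¹ (m<n*o⇒m/o<n (s≤s a+b≤b+w*c))
  where
  a+b≤b+w*c : a + b ≤ b + w * suc b
  a+b≤b+w*c = ≤-trans (+-monoˡ-≤ b a≤cw)
    (≤-reflexive (trans (+-comm (suc b * w) b) (cong (b +_) (*-comm (suc b) w))))

≤⌈/⌉ : ∀ {a c w} .{{_ : NonZero c}} → w * c ≤ a + (c ∸ 1) → w ≤ ⌈ a / c ⌉
≤⌈/⌉ {a} {suc b} {w} wc≤a+b = subst (_≤ ⌈ a / suc b ⌉) (m*n/n≡m w (suc b)) (/-monoˡ-≤ (suc b) wc≤a+b)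

weight-lower-bound : ∀ {n k} .{{_ : NonZero k}} → 1 ≤ n → (D : Digraph n) (f : Labelling n k) →
  IsTKRDF k D f → ⌈ k * n + 1 / Δ⁺ D + k ⌉ ≤ weight f
weight-lower-bound {suc n} {suc k} _ D f isTKRDF =
  ⌈/⌉≤ {{≢-nonZero (m+1+n≢0 (Δ⁺ D))}} (k*n+1≤[Δ⁺+k]*w D f isTKRDF zero zero)

⌈[2k+1]/[1+k]⌉≡2 : ∀ k .{{_ : NonZero k}} → ⌈ k * 2 + 1 / 1 + k ⌉ ≡ 2
⌈[2k+1]/[1+k]⌉≡2 k@(suc k′) =
  ≤-antisym (⌈/⌉≤ {k * 2 + 1} {1 + k} 2k+1≤[1+k]*2) (≤⌈/⌉ {k * 2 + 1} {1 + k} 2*[1+k]≤2k+1+k)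
  where
  2k+1≤[1+k]*2 : k * 2 + 1 ≤ (1 + k) * 2
  2k+1≤[1+k]*2 = ≤-trans (≤-reflexive (+-comm (k * 2) 1)) (n≤1+n (1 + k * 2))
  2*[2+k′]+k′≡2k+1+k : ∀ k′ → 2 * (2 + k′) + k′ ≡ suc k′ * 2 + 1 + suc k′
  2*[2+k′]+k′≡2k+1+k = solve-∀
  2*[1+k]≤2k+1+k : 2 * (1 + k) ≤ k * 2 + 1 + k
  2*[1+k]≤2k+1+k = ≤-trans (m≤m+n (2 * (1 + k)) k′) (≤-reflexive (2*[2+k′]+k′≡2k+1+k k′))

K₂ : Digraph 2
K₂ = record
  { arc      = λ u v → not ⌊ u ≟ᶠ v ⌋
  ; loopless = λ { zero → refl ; (suc zero) → refl }
  }

K₂-noIsolated : NoIsolated K₂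
K₂-noIsolated zero       (_ , no-out) = no-out (suc zero) tt
K₂-noIsolated (suc zero) (_ , no-out) = no-out zero tt

K₂-extremal : ∀ k .{{_ : NonZero k}} → IsGammaTRK k K₂ ⌈ k * 2 + 1 / Δ⁺ K₂ + k ⌉
K₂-extremal k@(suc _) =
  (singletons , (isKRDF , total) , trans weight≡2 (sym (⌈[2k+1]/[1+k]⌉≡2 k))) ,
  weight-lower-bound (s≤s z≤n) K₂
  where
  singletons : Labelling 2 k
  singletons _ = ⁅ zero ⁆
  labelled : ∀ v → ¬ IsEmpty (singletons v)
  labelled _ = ∈⇒nonempty (x∈⁅x⁆ {k} zero)
  isKRDF : IsKRDF k K₂ singletons
  isKRDF v fv≡∅ = ⊥-elim (labelled v fv≡∅)
  total : ∀ v → ¬ IsEmpty (singletons v) →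
    ∃ λ u → ¬ IsEmpty (singletons u) × (Arc K₂ u v ⊎ Arc K₂ v u)
  total zero       _ = suc zero , labelled (suc zero) , inj₁ tt
  total (suc zero) _ = zero , labelled zero , inj₁ tt
  weight≡2 : weight singletons ≡ 2
  weight≡2 = cong₂ _+_ (∣⁅x⁆∣≡1 {k} zero) (cong (_+ 0) (∣⁅x⁆∣≡1 {k} zero))

theorem3p2 :
    (∀ (k : ℕ) → .{{_ : NonZero k}} → ∀ (n : ℕ) → 1 ≤ n → (D : Digraph n) → NoIsolated D →
       ∀ γ → IsGammaTRK k D γ →
       ⌈ k * n + 1 / Δ⁺ D + k ⌉ ≤ γ)
    ×
    (∀ (k : ℕ) → .{{_ : NonZero k}} →
       ∃ λ n → 1 ≤ n × Σ (Digraph n) λ D → NoIsolated D ×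
         IsGammaTRK k D ⌈ k * n + 1 / Δ⁺ D + k ⌉)
theorem3p2 = γ-lower-bound , λ k → 2 , s≤s z≤n , K₂ , K₂-noIsolated , K₂-extremal k
  where
  γ-lower-bound : ∀ k .{{_ : NonZero k}} n → 1 ≤ n → (D : Digraph n) → NoIsolated D →
    ∀ γ → IsGammaTRK k D γ → ⌈ k * n + 1 / Δ⁺ D + k ⌉ ≤ γ
  γ-lower-bound k n n≥1 D _ γ ((f , isTKRDF , refl) , _) = weight-lower-bound n≥1 D f isTKRDF
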